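{- Let $(A,\cdot,\mathsf K,\mathsf S,\mathsf I)$ be a combinatory algebra, i.e. a set $A$ with a binary operation $\cdot$ (written left-associatively) and elements $\mathsf K,\mathsf S,\mathsf I\in A$ with $\mathsf I\cdot x=x$, $\mathsf K\cdot x\cdot y=x$ and $\mathsf S\cdot x\cdot y\cdot z=x\cdot z\cdot(y\cdot z)$ for all $x,y,z\in A$, and let $d:A\times A\to[0,\infty]$ be a pseudo-metric on $A$ such that $d(a\cdot b,a'\cdot b')\le\max\{d(a,a'),d(b,b')\}$ for all $a,a',b,b'\in A$. If the pseudo-metric space $(A,d)$ is compact, then it is trivial, i.e. $d(a,b)=0$ for all $a,b\in A$.
   Context: Such a structure is what the paper calls a one-sorted quantitative weak $\lambda$-algebra in $\mathrm{Met}$ (a quantitative algebra for combinatory logic with non-expansive application). A pseudo-metric may assign distance $0$ to distinct points. Compactness refers to the topology induced by $d$. -}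

module Defs where

open import Data.Rational using (ℚ; 0ℚ; _+_; _≤_; _<_)
open import Data.Product using (Σ; ∃; _×_)
open import Data.List using (List)
open import Data.List.Membership.Propositional using (_∈_)
open import Relation.Binary.PropositionalEquality using (_≡_)

record CombinatoryAlgebra (A : Set) : Set where
  infixl 9 _·_
  field
    _·_ : A → A → A
    K S I : A
    I-eq : ∀ x → I · x ≡ x
    K-eq : ∀ x y → K · x · y ≡ x
    S-eq : ∀ x y z → S · x · y · z ≡ x · z · (y · z)

-- A [0,∞]-valued pseudo-metric d on A, encoded (reals being unavailable)
-- by its closed sublevel relations:  a ≈[ ε ] b  means  d(a,b) ≤ ε.
-- The axioms below make  d(a,b) := inf { ε | a ≈[ ε ] b }  (inf ∅ = ∞)
-- a pseudo-metric with  a ≈[ ε ] b ⇔ d(a,b) ≤ ε, and conversely every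
-- [0,∞]-valued pseudo-metric arises this way.
record PseudoMetric (A : Set) : Set₁ where
  field
    _≈[_]_   : A → ℚ → A → Set
    nonneg   : ∀ {a b ε} → a ≈[ ε ] b → 0ℚ ≤ ε
    refl0    : ∀ a → a ≈[ 0ℚ ] a
    symm     : ∀ {a b ε} → a ≈[ ε ] b → b ≈[ ε ] a
    triangle : ∀ {a b c ε δ} → a ≈[ ε ] b → b ≈[ δ ] c → a ≈[ ε + δ ] c
    mono     : ∀ {a b ε δ} → ε ≤ δ → a ≈[ ε ] b → a ≈[ δ ] b
    closed   : ∀ {a b ε} → (∀ δ → ε < δ → a ≈[ δ ] b) → a ≈[ ε ] b

  Ball : A → ℚ → A → Set
  Ball x ε y = Σ ℚ (λ δ → (δ < ε) × (x ≈[ δ ] y))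

  IsOpen : (A → Set) → Set
  IsOpen U = ∀ x → U x → Σ ℚ (λ ε → (0ℚ < ε) × (∀ y → Ball x ε y → U y))

  Compact : Set₁
  Compact = (I : Set) (U : I → A → Set) →
            (∀ i → IsOpen (U i)) →
            (∀ x → Σ I (λ i → U i x)) →
            Σ (List I) (λ is → ∀ x → Σ I (λ i → (i ∈ is) × U i x))

NonExpansiveApp : {A : Set} → CombinatoryAlgebra A → PseudoMetric A → Set
NonExpansiveApp CA PM =
  ∀ {a a' b b' ε} → a ≈[ ε ] a' → b ≈[ ε ] b' → (a · b) ≈[ ε ] (a' · b')
  where open CombinatoryAlgebra CA
        open PseudoMetric PM

-- The combinators K and S·(S·I·(K·x))·(K·y) give Church pairs, so from a and b one builds
-- the nested pairs t₀ = ⟨a,a⟩, tₙ₊₁ = ⟨b,tₙ⟩ and non-expansive "projections" πᵢ (i times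
-- the second projection, then the first) with πᵢ tᵢ = a and πᵢ tⱼ = b for i < j.
-- A compact space is totally bounded, so by pigeonhole some tᵢ, tⱼ with i < j are closer
-- than any given δ > 0, whence d(a,b) = d(πᵢ tᵢ, πᵢ tⱼ) ≤ d(tᵢ, tⱼ) < δ.
module Submission where

open import Defs
open import Data.Rational using (ℚ; 0ℚ; ½; _+_; _-_; -_; _*_; _<_)
open import Data.Rational.Properties
  using (+-comm; +-assoc; +-identityˡ; +-inverseʳ; +-monoʳ-<; +-monoˡ-<; +-mono-<;
         *-distribʳ-+; *-identityˡ; *-zeroʳ; *-monoʳ-<-pos; <⇒≤)
open import Data.Nat as ℕ using (ℕ; zero; suc; s≤s; z<s)
open import Data.Nat.Properties using (n<1+n)
open import Data.Fin using (Fin; toℕ)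
open import Data.Fin.Properties using (pigeonhole)
open import Data.List using (List; length)
open import Data.List.Membership.Propositional using (_∈_)
open import Data.List.Membership.Setoid.Properties using (index-injective)
open import Data.List.Relation.Unary.Any using (index)
open import Data.Product using (Σ; ∃₂; _×_; _,_; proj₁; proj₂)
open import Relation.Binary.PropositionalEquality
  using (_≡_; sym; trans; cong; subst; subst₂; setoid; module ≡-Reasoning)

½*p+½*p≡p : ∀ p → ½ * p + ½ * p ≡ p
½*p+½*p≡p p = trans (sym (*-distribʳ-+ p ½ ½)) (*-identityˡ p)

½*-pos : ∀ {p} → 0ℚ < p → 0ℚ < ½ * p
½*-pos {p} 0<p = subst (_< ½ * p) (*-zeroʳ ½) (*-monoʳ-<-pos ½ 0<p)

p+[q-p]≡q : ∀ p q → p + (q - p) ≡ q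
p+[q-p]≡q p q = begin
  p + (q - p)     ≡⟨ cong (p +_) (+-comm q (- p)) ⟩
  p + (- p + q)   ≡⟨ sym (+-assoc p (- p) q) ⟩
  (p - p) + q     ≡⟨ cong (_+ q) (+-inverseʳ p) ⟩
  0ℚ + q          ≡⟨ +-identityˡ q ⟩
  q               ∎
  where open ≡-Reasoning

p<q⇒0<q-p : ∀ {p q} → p < q → 0ℚ < q - p
p<q⇒0<q-p {p} {q} p<q = subst (_< q - p) (+-inverseʳ p) (+-monoˡ-< (- p) p<q)

module CombinatoryPairs {A : Set} (CA : CombinatoryAlgebra A) where
  open CombinatoryAlgebra CA

  pair : A → A → A
  pair x y = S · (S · I · (K · x)) · (K · y)

  pair-· : ∀ x y z → pair x y · z ≡ z · x · y
  pair-· x y z = begin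
    S · (S · I · (K · x)) · (K · y) · z     ≡⟨ S-eq _ _ z ⟩
    S · I · (K · x) · z · (K · y · z)       ≡⟨ cong (S · I · (K · x) · z ·_) (K-eq y z) ⟩
    S · I · (K · x) · z · y                 ≡⟨ cong (_· y) (S-eq I (K · x) z) ⟩
    I · z · (K · x · z) · y                 ≡⟨ cong (λ w → w · (K · x · z) · y) (I-eq z) ⟩
    z · (K · x · z) · y                     ≡⟨ cong (λ w → z · w · y) (K-eq x z) ⟩
    z · x · y                               ∎
    where open ≡-Reasoning

  pair-fst : ∀ x y → pair x y · K ≡ x
  pair-fst x y = trans (pair-· x y K) (K-eq x y)

  pair-snd : ∀ x y → pair x y · (K · I) ≡ y
  pair-snd x y = trans (pair-· x y (K · I)) (trans (cong (_· y) (K-eq I x)) (I-eq y))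

  tower : A → A → ℕ → A
  tower a b zero    = pair a a
  tower a b (suc n) = pair b (tower a b n)

  project : ℕ → A → A
  project zero    x = x · K
  project (suc i) x = project i (x · (K · I))

  project-tower-≡ : ∀ a b i → project i (tower a b i) ≡ a
  project-tower-≡ a b zero    = pair-fst a a
  project-tower-≡ a b (suc i) = trans (cong (project i) (pair-snd b _)) (project-tower-≡ a b i)

  project-tower-< : ∀ a b {i j} → i ℕ.< j → project i (tower a b j) ≡ b
  project-tower-< a b {zero}  {suc j} z<s       = pair-fst b _
  project-tower-< a b {suc i} {suc j} (s≤s i<j) =
    trans (cong (project i) (pair-snd b _)) (project-tower-< a b i<j)

module PseudoMetricProperties {A : Set} (d : PseudoMetric A) where
  open PseudoMetric d

  ≈-refl-at : ∀ {x y ε} → x ≈[ ε ] y → ∀ z → z ≈[ ε ] z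
  ≈-refl-at x≈y z = mono (nonneg x≈y) (refl0 z)

  Ball⇒≈ : ∀ {x ε y} → Ball x ε y → x ≈[ ε ] y
  Ball⇒≈ (δ , δ<ε , x≈y) = mono (<⇒≤ δ<ε) x≈y

  Ball-isOpen : ∀ x ε → IsOpen (Ball x ε)
  Ball-isOpen x ε y (δ , δ<ε , x≈y) = ε - δ , p<q⇒0<q-p δ<ε , inner
    where
    inner : ∀ z → Ball y (ε - δ) z → Ball x ε z
    inner z (δ′ , δ′<ε-δ , y≈z) =
      δ + δ′ , subst (δ + δ′ <_) (p+[q-p]≡q δ ε) (+-monoʳ-< δ δ′<ε-δ) , triangle x≈y y≈z

  Cover : List A → ℚ → Set
  Cover cs ε = ∀ x → Σ A λ c → (c ∈ cs) × Ball c ε x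

  Compact⇒totallyBounded : Compact → ∀ {ε} → 0ℚ < ε → Σ (List A) λ cs → Cover cs ε
  Compact⇒totallyBounded compact {ε} 0<ε =
    compact A (λ c → Ball c ε) (λ c → Ball-isOpen c ε) (λ x → x , 0ℚ , 0<ε , refl0 x)

  ballIndex : ∀ {cs ε} → Cover cs ε → A → Fin (length cs)
  ballIndex cover x = index (proj₁ (proj₂ (cover x)))

  sameBall⇒Ball : ∀ {cs ε} (cover : Cover cs ε) {x y} →
                  ballIndex cover x ≡ ballIndex cover y → Ball x (ε + ε) y
  sameBall⇒Ball {ε = ε} cover {x} {y} same
    with c , c∈cs , (η , η<ε , c≈x) ← cover x
       | c′ , c′∈cs , (η′ , η′<ε , c′≈y) ← cover y
    = η + η′ , +-mono-< η<ε η′<ε , triangle (symm c≈x) c≈y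
    where
    c≈y : c ≈[ η′ ] y
    c≈y = subst (λ z → z ≈[ η′ ] y) (sym (index-injective (setoid A) c∈cs c′∈cs same)) c′≈y

  Compact⇒close-terms : Compact → (s : ℕ → A) → ∀ {δ} → 0ℚ < δ →
    ∃₂ λ i j → i ℕ.< j × Ball (s i) δ (s j)
  Compact⇒close-terms compact s {δ} 0<δ
    with cs , cover ← Compact⇒totallyBounded compact (½*-pos 0<δ)
    with i , j , i<j , same ← pigeonhole (n<1+n (length cs)) (λ k → ballIndex cover (s (toℕ k)))
    = toℕ i , toℕ j , i<j , subst (λ ε → Ball (s (toℕ i)) ε (s (toℕ j))) (½*p+½*p≡p δ)
                                  (sameBall⇒Ball cover same)

module NonExpansiveApplication {A : Set} (CA : CombinatoryAlgebra A) (d : PseudoMetric A)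
                               (nonExpansive : NonExpansiveApp CA d) where
  open CombinatoryAlgebra CA
  open PseudoMetric d
  open PseudoMetricProperties d
  open CombinatoryPairs CA

  ·-congʳ : ∀ {x y ε} → x ≈[ ε ] y → ∀ z → (x · z) ≈[ ε ] (y · z)
  ·-congʳ x≈y z = nonExpansive x≈y (≈-refl-at x≈y z)

  project-nonExpansive : ∀ i {x y ε} → x ≈[ ε ] y → project i x ≈[ ε ] project i y
  project-nonExpansive zero    x≈y = ·-congʳ x≈y K
  project-nonExpansive (suc i) x≈y = project-nonExpansive i (·-congʳ x≈y (K · I))

  tower-separates : ∀ a b {i j ε} → i ℕ.< j → tower a b i ≈[ ε ] tower a b j → a ≈[ ε ] b
  tower-separates a b {i} {ε = ε} i<j tᵢ≈tⱼ =
    subst₂ (λ x y → x ≈[ ε ] y) (project-tower-≡ a b i) (project-tower-< a b i<j)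
      (project-nonExpansive i tᵢ≈tⱼ)

mainTheorem4 : (A : Set) (CA : CombinatoryAlgebra A) (d : PseudoMetric A) →
    NonExpansiveApp CA d →
    PseudoMetric.Compact d →
    ∀ a b → PseudoMetric._≈[_]_ d a 0ℚ b
mainTheorem4 A CA d nonExpansive compact a b =
  closed λ δ 0<δ → a≈b (Compact⇒close-terms compact (tower a b) 0<δ)
  where
  open PseudoMetric d
  open PseudoMetricProperties d
  open CombinatoryPairs CA
  open NonExpansiveApplication CA d nonExpansive

  a≈b : ∀ {δ} → ∃₂ (λ i j → i ℕ.< j × Ball (tower a b i) δ (tower a b j)) → a ≈[ δ ] b
  a≈b (i , j , i<j , tᵢ≈tⱼ) = tower-separates a b i<j (Ball⇒≈ tᵢ≈tⱼ)
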